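{- For every index $i$ and every $n$: if $A_i\cap B^n\neq\emptyset$ then for all $y$, $\lim_s B(i,n,y,s)<\infty$; and if $A_i\cap B^n=\emptyset$ then there exists $y_0$ such that for all $y>y_0$, $\lim_s B(i,n,y,s)=\infty$.
   Context: $\mu(x)$ is the largest exponent in the binary expansion of $x\in\mathbb{Z}^+$, and $B^n=\{x\in\mathbb{Z}^+:\mu(x)=n\}$. Let $W_e$ be the $e$-th recursively enumerable set and $W_{e,s}$ its stage-$s$ approximation. Let $\Phi_i(x,y)$ be the $i$-th $\Sigma^0_2$ formula and $g$ a total recursive function such that $\Phi_i(x,y)$ holds iff $W_{g(i,x,y)}$ is finite. Set $F(i,x,y,s)=\max_{y'\leq y}|W_{g(i,x,y'),s}|$ (non-decreasing in $y$ and in $s$) and $A_i=\{x:\forall y\ \lim_s F(i,x,y,s)<\infty\}$. Define $B(i,n,y,s)=\min\{F(i,x,y,s):x\in B^n\}$. -}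

module Defs where

open import Level using (0ℓ)
open import Data.Bool using (Bool; true; false; if_then_else_)
open import Data.Nat using (ℕ; zero; suc; _+_; _^_; _≤_; _<_; _⊔_; _⊓_; _≤?_; _≟_)
open import Data.Nat.Logarithm using (⌊log₂_⌋)
open import Data.List using (List; []; _∷_; upTo; filter; map)
open import Data.Product using (_×_; ∃-syntax)
open import Relation.Binary.PropositionalEquality using (_≡_)
open import Relation.Nullary.Decidable using (_×-dec_)

μ : ℕ → ℕ
μ x = ⌊log₂ x ⌋

InB : ℕ → ℕ → Set
InB n x = (1 ≤ x) × (μ x ≡ n)

-- Bⁿ as an explicit finite list: every x ∈ Bⁿ satisfies x < 2^(n+1),
-- so Bⁿ = the elements of [0, 2^(n+1)) satisfying InB n.
Bset : ℕ → List ℕ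
Bset n = filter (λ x → (1 ≤? x) ×-dec (μ x ≟ n)) (upTo (2 ^ suc n))

-- minimum of a list of naturals (only used on nonempty lists)
minList : List ℕ → ℕ
minList []       = 0
minList (a ∷ []) = a
minList (a ∷ as) = a ⊓ minList as

-- A stage-wise enumeration of r.e. sets: W e s x = true  iff  x ∈ W_{e,s}.
-- Standard conventions: W_{e,s} ⊆ [0,s), and W_{e,s} ⊆ W_{e,s+1}.
Enumeration : Set
Enumeration = ℕ → ℕ → ℕ → Bool

count : (ℕ → Bool) → List ℕ → ℕ
count p []       = 0
count p (x ∷ xs) = (if p x then 1 else 0) + count p xs

card : Enumeration → ℕ → ℕ → ℕ
card W e s = count (W e s) (upTo s)

FiniteRE : Enumeration → ℕ → Set
FiniteRE W e = ∃[ N ] (∀ s x → W e s x ≡ true → x < N)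

F : Enumeration → (ℕ → ℕ → ℕ → ℕ) → ℕ → ℕ → ℕ → ℕ → ℕ
F W g i x zero    s = card W (g i x zero) s
F W g i x (suc y) s = F W g i x y s ⊔ card W (g i x (suc y)) s

-- lim_s f(s) < ∞   (for non-decreasing f : ℕ → ℕ)
LimFinite : (ℕ → ℕ) → Set
LimFinite f = ∃[ N ] (∀ s → f s ≤ N)

LimInfinite : (ℕ → ℕ) → Set
LimInfinite f = ∀ N → ∃[ s ] (N ≤ f s)

InA : Enumeration → (ℕ → ℕ → ℕ → ℕ) → ℕ → ℕ → Set
InA W g i x = ∀ y → LimFinite (λ s → F W g i x y s)

Bfun : Enumeration → (ℕ → ℕ → ℕ → ℕ) → ℕ → ℕ → ℕ → ℕ → ℕ
Bfun W g i n y s = minList (map (λ x → F W g i x y s) (Bset n))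

{-# OPTIONS --safe #-}
-- The enumeration is monotone, so F(i,x,y,s) is non-decreasing in both y and s,
-- and Bⁿ is a finite nonempty set. If some x ∈ Aᵢ ∩ Bⁿ, its bound on F(i,x,y,·)
-- bounds the minimum B(i,n,y,·). Otherwise, classically, each x ∈ Bⁿ has some yₓ
-- with lim_s F(i,x,yₓ,s) = ∞; taking y₀ = max yₓ over the finitely many x and using
-- monotonicity in y, for y > y₀ all F(i,x,y,·) with x ∈ Bⁿ, hence their minimum,
-- exceed any bound at a common stage.
module Submission where

open import Defs
open import Level using (0ℓ)
open import Axiom.ExcludedMiddle using (ExcludedMiddle)
open import Axiom.DoubleNegationElimination using (DoubleNegationElimination; em⇒dne)
open import Data.Bool using (true; false; if_then_else_)
open import Data.Nat using (ℕ; zero; suc; _<_; _≤_; _≤′_; ≤′-refl; ≤′-step; z≤n; s≤s; _+_; _^_; _⊔_; _≤?_; _≟_)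
open import Data.Nat.Properties
open import Data.Nat.Logarithm using (⌊log₂⌋-mono-≤; ⌊log₂[2^n]⌋≡n)
open import Data.List using ([]; _∷_; _++_; _∷ʳ_; map; upTo)
open import Data.List.Properties using (applyUpTo-∷ʳ)
open import Data.List.Membership.Propositional using (_∈_)
open import Data.List.Membership.Propositional.Properties using (∈-upTo⁺; ∈-filter⁺; ∈-filter⁻; ∈-map⁺)
open import Data.List.Relation.Unary.Any using (here; there)
open import Data.List.Relation.Unary.All as All using (All; []; _∷_)
open import Data.List.Relation.Unary.All.Properties using (map⁺)
open import Data.Product using (_×_; ∃-syntax; _,_; proj₂)
open import Relation.Nullary using (¬_)
open import Relation.Nullary.Decidable using (_×-dec_)
open import Relation.Binary.Core using (_Preserves_⟶_)
open import Relation.Binary.PropositionalEquality using (_≡_; refl; sym; cong)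
open import Function.Base using (id)
open import Function.Bundles using (_⇔_)

monotone-if-step : (f : ℕ → ℕ) → (∀ n → f n ≤ f (suc n)) → f Preserves _≤_ ⟶ _≤_
monotone-if-step f step m≤n = go (≤⇒≤′ m≤n)
  where
  go : ∀ {m n} → m ≤′ n → f m ≤ f n
  go ≤′-refl        = ≤-refl
  go (≤′-step m≤′n) = ≤-trans (go m≤′n) (step _)

count-++ : ∀ p xs ys → count p (xs ++ ys) ≡ count p xs + count p ys
count-++ p []       ys = refl
count-++ p (x ∷ xs) ys rewrite count-++ p xs ys = sym (+-assoc (if p x then 1 else 0) _ _)

count-mono : ∀ p q → (∀ x → p x ≡ true → q x ≡ true) → ∀ xs → count p xs ≤ count q xs
count-mono p q p⇒q []       = z≤n
count-mono p q p⇒q (x ∷ xs) with p x in px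
... | true rewrite p⇒q x px = s≤s (count-mono p q p⇒q xs)
... | false = ≤-trans (count-mono p q p⇒q xs) (m≤n+m _ _)

minList-≤ : ∀ {x} L → x ∈ L → minList L ≤ x
minList-≤ (a ∷ [])     (here refl) = ≤-refl
minList-≤ (a ∷ b ∷ bs) (here refl) = m⊓n≤m _ _
minList-≤ (a ∷ b ∷ bs) (there x∈) = ≤-trans (m⊓n≤n a _) (minList-≤ (b ∷ bs) x∈)

minList-glb : ∀ {N x} L → x ∈ L → All (N ≤_) L → N ≤ minList L
minList-glb (a ∷ [])     _ (N≤a ∷ [])  = N≤a
minList-glb (a ∷ b ∷ bs) _ (N≤a ∷ N≤bs) = ⊓-glb N≤a (minList-glb (b ∷ bs) (here refl) N≤bs)

module _ (dne : DoubleNegationElimination 0ℓ) where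

  ¬LimFinite⇒LimInfinite : ∀ f → ¬ LimFinite f → LimInfinite f
  ¬LimFinite⇒LimInfinite f unbounded N =
    dne λ ¬reached → unbounded (N , λ s → <⇒≤ (≰⇒> λ N≤fs → ¬reached (s , N≤fs)))

  ¬∀LimFinite⇒∃LimInfinite : (f : ℕ → ℕ → ℕ) → ¬ (∀ y → LimFinite (f y)) → ∃[ y ] LimInfinite (f y)
  ¬∀LimFinite⇒∃LimInfinite f ¬allFinite =
    dne λ ¬∃ → ¬allFinite λ y → dne λ ¬finite → ¬∃ (y , ¬LimFinite⇒LimInfinite (f y) ¬finite)

module _ (h : ℕ → ℕ → ℕ → ℕ)
         (mono-y : ∀ x s → (λ y → h x y s) Preserves _≤_ ⟶ _≤_)
         (mono-s : ∀ x y → h x y Preserves _≤_ ⟶ _≤_) where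

  eventually-jointly-unbounded : ∀ L → All (λ x → ∃[ y ] LimInfinite (h x y)) L →
    ∃[ y₀ ] ∀ y → y₀ ≤ y → ∀ N → ∃[ s ] All (λ x → N ≤ h x y s) L
  eventually-jointly-unbounded []      []                  = 0 , λ _ _ _ → 0 , []
  eventually-jointly-unbounded (x ∷ L) ((yₓ , unbₓ) ∷ unbL)
    with y₁ , jointL ← eventually-jointly-unbounded L unbL =
    yₓ ⊔ y₁ , λ y y₀≤y N →
      let sₓ , N≤hₓ = unbₓ N
          sL , N≤hL = jointL y (≤-trans (m≤n⊔m yₓ y₁) y₀≤y) N
      in  sₓ ⊔ sL
        , ≤-trans N≤hₓ (≤-trans (mono-s x yₓ (m≤m⊔n sₓ sL))
                                (mono-y x (sₓ ⊔ sL) (≤-trans (m≤m⊔n yₓ y₁) y₀≤y)))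
          ∷ All.map (λ {z} N≤hz → ≤-trans N≤hz (mono-s z y (m≤n⊔m sₓ sL))) N≤hL

<2^[1+μ] : ∀ x → x < 2 ^ suc (μ x)
<2^[1+μ] x = ≰⇒> λ 2^[1+μ]≤x →
  1+n≰n (≤-trans (≤-reflexive (sym (⌊log₂[2^n]⌋≡n (suc (μ x))))) (⌊log₂⌋-mono-≤ 2^[1+μ]≤x))

Bset-complete : ∀ {n x} → InB n x → x ∈ Bset n
Bset-complete {n} {x} (1≤x , refl) = ∈-filter⁺ (λ x → (1 ≤? x) ×-dec (μ x ≟ n)) (∈-upTo⁺ (<2^[1+μ] x)) (1≤x , refl)

Bset-sound : ∀ n → All (InB n) (Bset n)
Bset-sound n = All.tabulate λ x∈ → proj₂ (∈-filter⁻ (λ x → (1 ≤? x) ×-dec (μ x ≟ n)) {xs = upTo (2 ^ suc n)} x∈)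

2^n∈Bset : ∀ n → 2 ^ n ∈ Bset n
2^n∈Bset n = Bset-complete (m^n>0 2 n , ⌊log₂[2^n]⌋≡n n)

module _ (W : Enumeration) (W-mono : ∀ e s x → W e s x ≡ true → W e (suc s) x ≡ true)
         (g : ℕ → ℕ → ℕ → ℕ) (i : ℕ) where

  card-step : ∀ e s → card W e s ≤ card W e (suc s)
  card-step e s = begin
      count (W e s) (upTo s)
    ≤⟨ count-mono (W e s) (W e (suc s)) (W-mono e s) (upTo s) ⟩
      count (W e (suc s)) (upTo s)
    ≤⟨ m≤m+n _ _ ⟩
      count (W e (suc s)) (upTo s) + count (W e (suc s)) (s ∷ [])
    ≡⟨ sym (count-++ (W e (suc s)) (upTo s) (s ∷ [])) ⟩
      count (W e (suc s)) (upTo s ∷ʳ s)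
    ≡⟨ cong (count (W e (suc s))) (applyUpTo-∷ʳ id s) ⟩
      count (W e (suc s)) (upTo (suc s))
    ∎
    where open ≤-Reasoning

  F-step-s : ∀ x y s → F W g i x y s ≤ F W g i x y (suc s)
  F-step-s x zero    s = card-step (g i x zero) s
  F-step-s x (suc y) s = ⊔-mono-≤ (F-step-s x y s) (card-step (g i x (suc y)) s)

  F-mono-s : ∀ x y → F W g i x y Preserves _≤_ ⟶ _≤_
  F-mono-s x y = monotone-if-step (F W g i x y) (F-step-s x y)

  F-mono-y : ∀ x s → (λ y → F W g i x y s) Preserves _≤_ ⟶ _≤_
  F-mono-y x s = monotone-if-step (λ y → F W g i x y s) (λ _ → m≤m⊔n _ _)

  Bfun-≤ : ∀ {n x} y s → InB n x → Bfun W g i n y s ≤ F W g i x y s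
  Bfun-≤ y s x∈Bⁿ = minList-≤ _ (∈-map⁺ (λ x → F W g i x y s) (Bset-complete x∈Bⁿ))

  Bfun-glb : ∀ {N} n y s → All (λ x → N ≤ F W g i x y s) (Bset n) → N ≤ Bfun W g i n y s
  Bfun-glb n y s N≤F = minList-glb _ (∈-map⁺ (λ x → F W g i x y s) (2^n∈Bset n)) (map⁺ N≤F)

mainTheorem13 : ExcludedMiddle 0ℓ →
    (W : Enumeration) →
    (∀ e s x → W e s x ≡ true → x < s) →
    (∀ e s x → W e s x ≡ true → W e (suc s) x ≡ true) →
    (Φ : ℕ → ℕ → ℕ → Set) →
    (g : ℕ → ℕ → ℕ → ℕ) →
    (∀ i x y → Φ i x y ⇔ FiniteRE W (g i x y)) →
    ∀ i n →
      ((∃[ x ] (InA W g i x × InB n x)) →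
         ∀ y → LimFinite (λ s → Bfun W g i n y s))
      ×
      (¬ (∃[ x ] (InA W g i x × InB n x)) →
         ∃[ y₀ ] (∀ y → y₀ < y → LimInfinite (λ s → Bfun W g i n y s)))
mainTheorem13 em W _ W-mono _ g _ i n = bounded , unbounded
  where
  bounded : ∃[ x ] (InA W g i x × InB n x) → ∀ y → LimFinite (λ s → Bfun W g i n y s)
  bounded (x , x∈Aᵢ , x∈Bⁿ) y with N , F≤N ← x∈Aᵢ y =
    N , λ s → ≤-trans (Bfun-≤ W W-mono g i y s x∈Bⁿ) (F≤N s)

  unbounded-at-some-y : ¬ (∃[ x ] (InA W g i x × InB n x)) →
                        ∀ {x} → InB n x → ∃[ y ] LimInfinite (F W g i x y)
  unbounded-at-some-y Aᵢ∩Bⁿ=∅ {x} x∈Bⁿ =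
    ¬∀LimFinite⇒∃LimInfinite (em⇒dne em) (F W g i x) λ x∈Aᵢ → Aᵢ∩Bⁿ=∅ (x , x∈Aᵢ , x∈Bⁿ)

  unbounded : ¬ (∃[ x ] (InA W g i x × InB n x)) →
              ∃[ y₀ ] (∀ y → y₀ < y → LimInfinite (λ s → Bfun W g i n y s))
  unbounded Aᵢ∩Bⁿ=∅
    with y₀ , joint ← eventually-jointly-unbounded (F W g i) (F-mono-y W W-mono g i) (F-mono-s W W-mono g i)
                        (Bset n) (All.map (unbounded-at-some-y Aᵢ∩Bⁿ=∅) (Bset-sound n)) =
    y₀ , λ y y₀<y N → let s , N≤F = joint y (<⇒≤ y₀<y) N in s , Bfun-glb W W-mono g i n y s N≤F
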